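{- Let $G$ be a connected graph without cut-vertex that is not a clique and in which no vertex has a neighborhood that is a stable set. Let $X\subseteq V(G)$ be such that $G-X$ is a co-cluster graph that is the join of at least four stable sets (parts). Suppose $v\in V(G)\setminus X$ is such that every neighbor $x\in N(v)\cap X$ is adjacent to vertices of at least three different parts of $G-X$ (the part containing $v$ included). Then $G$ has a stable cutset if and only if $G-v$ has a stable cutset.
   Context: All graphs are finite and simple. A stable cutset of a graph $G$ is a set $S\subseteq V(G)$ whose vertices are pairwise non-adjacent and such that $G-S$ is disconnected (has at least two connected components); the empty set is a stable cutset of any disconnected graph. A cut-vertex is a vertex whose removal disconnects the graph. A co-cluster graph is a graph whose complement is a disjoint union of cliques; equivalently it is the join (complete multipartite graph) of the stable sets given by the vertex sets of the connected components of its complement; these stable sets are its parts. -}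

module Defs where

open import Data.Nat using (ℕ; _≤_)
open import Data.Fin using (Fin)
open import Data.Bool using (Bool; true; false)
open import Data.Product using (Σ; ∃; ∃-syntax; _×_; _,_)
open import Relation.Binary.PropositionalEquality using (_≡_; _≢_)
open import Relation.Nullary using (¬_)
open import Relation.Nullary.Decidable using (⌊_⌋)
open import Data.Fin using (_≟_)

record Graph : Set where
  field
    n      : ℕ
    adj    : Fin n → Fin n → Bool
    sym    : ∀ x y → adj x y ≡ adj y x
    irrefl : ∀ x → adj x x ≡ false

open Graph public

Vertex : Graph → Set
Vertex G = Fin (n G)

Adj : (G : Graph) → Vertex G → Vertex G → Set
Adj G x y = adj G x y ≡ true

VSet : Graph → Set
VSet G = Vertex G → Bool

_∈_ : ∀ {A : Set} → A → (A → Bool) → Set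
x ∈ S = S x ≡ true

_∉_ : ∀ {A : Set} → A → (A → Bool) → Set
x ∉ S = S x ≡ false

data Reach (G : Graph) (U : VSet G) : Vertex G → Vertex G → Set where
  here : ∀ {x} → U x ≡ true → Reach G U x x
  step : ∀ {x y z} → U x ≡ true → Adj G x y → Reach G U y z → Reach G U x z

Disconnected : (G : Graph) → VSet G → Set
Disconnected G U = ∃[ x ] ∃[ y ] (U x ≡ true × U y ≡ true × ¬ Reach G U x y)

Connected : (G : Graph) → VSet G → Set
Connected G U = ∀ x y → U x ≡ true → U y ≡ true → Reach G U x y

All : (G : Graph) → VSet G
All G _ = true

_∖_ : ∀ {A : Set} → (A → Bool) → (A → Bool) → (A → Bool)
(U ∖ S) x with S x
... | true  = false
... | false = U x

⟦_⟧ : ∀ {m} → Fin m → (Fin m → Bool)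
⟦ v ⟧ x = ⌊ v ≟ x ⌋

Stable : (G : Graph) → VSet G → Set
Stable G S = ∀ x y → x ∈ S → y ∈ S → ¬ Adj G x y

N : (G : Graph) → Vertex G → VSet G
N G v = adj G v

-- stable cutset of the induced subgraph G[U] (U = V(G) gives G, U = V(G)∖{v} gives G − v):
-- S ⊆ U, S stable, and G[U ∖ S] disconnected
StableCutsetIn : (G : Graph) → VSet G → VSet G → Set
StableCutsetIn G U S = (∀ x → x ∈ S → x ∈ U) × Stable G S × Disconnected G (U ∖ S)

HasStableCutset : Graph → Set
HasStableCutset G = ∃[ S ] StableCutsetIn G (All G) S

HasStableCutsetMinus : (G : Graph) → Vertex G → Set
HasStableCutsetMinus G v = ∃[ S ] StableCutsetIn G (All G ∖ ⟦ v ⟧) S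

IsCutVertex : (G : Graph) → Vertex G → Set
IsCutVertex G v = Disconnected G (All G ∖ ⟦ v ⟧)

IsClique : Graph → Set
IsClique G = ∀ x y → x ≢ y → Adj G x y

-- G − X is a co-cluster graph which is the join of exactly k non-empty stable parts,
-- the part of a vertex u ∉ X being p u (values of p on X are irrelevant).
-- Two distinct vertices of G − X are adjacent iff they lie in different parts,
-- so the parts are exactly the components of the complement of G − X.
IsCoClusterJoin : (G : Graph) → VSet G → (k : ℕ) → (Vertex G → Fin k) → Set
IsCoClusterJoin G X k p =
  (∀ (i : Fin k) → ∃[ u ] (u ∉ X × p u ≡ i)) ×
  (∀ u w → u ∉ X → w ∉ X → u ≢ w →
     (Adj G u w → p u ≢ p w) × (p u ≢ p w → Adj G u w))

{-# OPTIONS --safe #-}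
module Submission where

-- Since G − X is complete multipartite, a stable set S meets G − X inside a single part. With at
-- least four parts, all vertices of G − X − S − v then lie in one component of G − S − v: route
-- through two parts avoiding the part of S and that of v. Every neighbour of v lies in that
-- component too: directly if it is outside X, and otherwise through one of its neighbours in three
-- distinct parts, at most one of which meets S and at most one of which contains v. So deleting v
-- from G − S (or adding it back) neither merges nor destroys components, while a stable cutset
-- containing v simply loses v.

open import Defs
open import Data.Nat using (ℕ; _≤_)
open import Data.Fin using (Fin)
open import Data.Product using (Σ; ∃; ∃-syntax; _×_; _,_)
open import Relation.Binary.PropositionalEquality using (_≡_; _≢_)
open import Relation.Nullary using (¬_)

open import Data.Bool using (Bool; true; false; if_then_else_)
open import Data.Bool.Properties using () renaming (_≟_ to _≟ᵇ_)
open import Data.Empty using (⊥)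
open import Data.Fin using (zero; suc; _≟_)
open import Data.Fin.Properties using (any?; all?; ¬∀⟶∃¬; injective⇒≤)
open import Data.Nat using (_<_)
open import Data.Nat.Properties using (<⇒≱; ≤-trans; n≤1+n)
open import Data.Product using (proj₁; proj₂)
open import Data.Sum using (_⊎_; inj₁; inj₂)
open import Data.Vec.Functional using ([]; _∷_)
open import Function.Base using (case_of_)
open import Function.Definitions using (Injective)
open import Relation.Binary.PropositionalEquality
  using (refl; cong; trans; subst; subst₂; _≗_) renaming (sym to ≡-sym)
open import Relation.Nullary using (yes; no; contradiction)
open import Relation.Nullary.Decidable using (_×-dec_)

missed-value : ∀ {m k} → m < k → (g : Fin m → Fin k) → ∃[ e ] ∀ j → g j ≢ e
missed-value {k = k} m<k g with all? (λ e → any? (λ j → g j ≟ e))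
... | no ¬onto with e , ¬hit ← ¬∀⟶∃¬ k _ (λ e → any? (λ j → g j ≟ e)) ¬onto
  = e , λ j hit → ¬hit (j , hit)
... | yes onto = contradiction (injective⇒≤ section-injective) (<⇒≱ m<k)
  where
  section-injective : Injective _≡_ _≡_ (λ e → proj₁ (onto e))
  section-injective {e₁} {e₂} eq =
    trans (≡-sym (proj₂ (onto e₁))) (trans (cong g eq) (proj₂ (onto e₂)))

no-three-distinct-in-pair : ∀ {A : Set} {a b x y z : A} → x ≢ y → x ≢ z → y ≢ z →
  x ≡ a ⊎ x ≡ b → y ≡ a ⊎ y ≡ b → z ≡ a ⊎ z ≡ b → ⊥
no-three-distinct-in-pair x≢y _   _   (inj₁ refl) (inj₁ refl) _           = x≢y refl
no-three-distinct-in-pair x≢y _   _   (inj₂ refl) (inj₂ refl) _           = x≢y refl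
no-three-distinct-in-pair _   x≢z _   (inj₁ refl) (inj₂ refl) (inj₁ refl) = x≢z refl
no-three-distinct-in-pair _   _   y≢z (inj₁ refl) (inj₂ refl) (inj₂ refl) = y≢z refl
no-three-distinct-in-pair _   _   y≢z (inj₂ refl) (inj₁ refl) (inj₁ refl) = y≢z refl
no-three-distinct-in-pair _   x≢z _   (inj₂ refl) (inj₁ refl) (inj₂ refl) = x≢z refl

module _ {A : Set} where

  ∈-∖ : (U T : A → Bool) → ∀ {x} → x ∈ U → x ∉ T → x ∈ (U ∖ T)
  ∈-∖ U T x∈U x∉T rewrite x∉T = x∈U

  ∈-∖⁻ : (U T : A → Bool) → ∀ {x} → x ∈ (U ∖ T) → x ∈ U × x ∉ T
  ∈-∖⁻ U T {x} x∈ with T x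
  ∈-∖⁻ U T () | true
  ∈-∖⁻ U T x∈ | false = x∈ , refl

  ∖-if : (U T : A → Bool) → ∀ z → (U ∖ T) z ≡ (if T z then false else U z)
  ∖-if U T z with T z
  ... | true  = refl
  ... | false = refl

  ∖-comm : (U S T : A → Bool) → (U ∖ S) ∖ T ≗ (U ∖ T) ∖ S
  ∖-comm U S T z
    rewrite ∖-if (U ∖ S) T z | ∖-if U S z | ∖-if (U ∖ T) S z | ∖-if U T z
    with S z | T z
  ... | true  | true  = refl
  ... | true  | false = refl
  ... | false | _     = refl

  ∖-absorb : (U S T : A → Bool) → (∀ z → z ∈ T → z ∈ S) → (U ∖ T) ∖ (S ∖ T) ≗ U ∖ S
  ∖-absorb U S T T⊆S z
    rewrite ∖-if (U ∖ T) (S ∖ T) z | ∖-if S T z | ∖-if U T z | ∖-if U S z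
    with T z in z∈?T | S z in z∈?S
  ... | true  | true  = refl
  ... | true  | false = contradiction (trans (≡-sym z∈?S) (T⊆S z z∈?T)) λ ()
  ... | false | _     = refl

module _ {m : ℕ} where

  ∈-⟦⟧ : (v : Fin m) → v ∈ ⟦ v ⟧
  ∈-⟦⟧ v with v ≟ v
  ... | yes _   = refl
  ... | no v≢v = contradiction refl v≢v

  ∈-⟦⟧⁻ : ∀ {v x : Fin m} → x ∈ ⟦ v ⟧ → v ≡ x
  ∈-⟦⟧⁻ {v} {x} x∈ with v ≟ x
  ∈-⟦⟧⁻ _  | yes v≡x = v≡x
  ∈-⟦⟧⁻ () | no _

  ∉-⟦⟧ : ∀ {v x : Fin m} → v ≢ x → x ∉ ⟦ v ⟧
  ∉-⟦⟧ {v} {x} v≢x with v ≟ x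
  ... | yes v≡x = contradiction v≡x v≢x
  ... | no _    = refl

  ∉-⟦⟧⁻ : ∀ {v x : Fin m} → x ∉ ⟦ v ⟧ → v ≢ x
  ∉-⟦⟧⁻ {v} x∉ refl = contradiction (trans (≡-sym x∉) (∈-⟦⟧ v)) λ ()

  redirect : Fin m → Fin m → Fin m → Fin m
  redirect v c x with v ≟ x
  ... | yes _ = c
  ... | no _  = x

  redirect-≢ : ∀ {v c x : Fin m} → v ≢ x → redirect v c x ≡ x
  redirect-≢ {v} {c} {x} v≢x with v ≟ x
  ... | yes v≡x = contradiction v≡x v≢x
  ... | no _    = refl

module _ {G : Graph} where

  adj-sym : ∀ {x y} → Adj G x y → Adj G y x
  adj-sym {x} {y} e = trans (sym G y x) e

  adj-≢ : ∀ {x y} → Adj G x y → x ≢ y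
  adj-≢ {x} e refl = contradiction (trans (≡-sym (irrefl G x)) e) λ ()

  reach-start : ∀ {U a b} → Reach G U a b → a ∈ U
  reach-start (here a∈U)     = a∈U
  reach-start (step a∈U _ _) = a∈U

  reach-mono : ∀ {U V} → (∀ z → z ∈ U → z ∈ V) → ∀ {a b} → Reach G U a b → Reach G V a b
  reach-mono U⊆V (here a∈U)     = here (U⊆V _ a∈U)
  reach-mono U⊆V (step a∈U e r) = step (U⊆V _ a∈U) e (reach-mono U⊆V r)

  reach-trans : ∀ {U a b c} → Reach G U a b → Reach G U b c → Reach G U a c
  reach-trans (here _)       s = s
  reach-trans (step a∈U e r) s = step a∈U e (reach-trans r s)

  reach-sym : ∀ {U a b} → Reach G U a b → Reach G U b a
  reach-sym (here a∈U) = here a∈U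
  reach-sym (step a∈U e r) =
    reach-trans (reach-sym r) (step (reach-start r) (adj-sym e) (here a∈U))

  disconnected-resp-≗ : ∀ {U V} → U ≗ V → Disconnected G U → Disconnected G V
  disconnected-resp-≗ U≗V (x , y , x∈U , y∈U , x↛y) =
    x , y , trans (≡-sym (U≗V x)) x∈U , trans (≡-sym (U≗V y)) y∈U ,
    λ r → x↛y (reach-mono (λ z z∈V → trans (U≗V z) z∈V) r)

record NeighboursInComponentOf (G : Graph) (U : VSet G) (v c : Vertex G) : Set where
  field
    centre-∈ : c ∈ (U ∖ ⟦ v ⟧)
    neighbour-reaches : ∀ z → z ∈ (U ∖ ⟦ v ⟧) → Adj G v z → Reach G (U ∖ ⟦ v ⟧) z c

module _ {G : Graph} {U : VSet G} {v c : Vertex G} where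
  open NeighboursInComponentOf

  ∈-minus : ∀ {a} → a ∈ U → v ≢ a → a ∈ (U ∖ ⟦ v ⟧)
  ∈-minus a∈U v≢a = ∈-∖ U ⟦ v ⟧ a∈U (∉-⟦⟧ v≢a)

  redirect-∈ : c ∈ (U ∖ ⟦ v ⟧) → ∀ {a} → a ∈ U → redirect v c a ∈ (U ∖ ⟦ v ⟧)
  redirect-∈ c∈ {a} a∈U with v ≟ a
  ... | yes _   = c∈
  ... | no v≢a = ∈-minus a∈U v≢a

  reach-redirect : NeighboursInComponentOf G U v c → ∀ {a b} → Reach G U a b →
                   Reach G (U ∖ ⟦ v ⟧) (redirect v c a) (redirect v c b)
  reach-redirect nb (here a∈U)     = here (redirect-∈ (centre-∈ nb) a∈U)
  reach-redirect nb (step a∈U e r) = reach-trans (edge a∈U (reach-start r) e) (reach-redirect nb r)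
    where
    open NeighboursInComponentOf nb renaming (centre-∈ to c∈; neighbour-reaches to joins)
    edge : ∀ {a b} → a ∈ U → b ∈ U → Adj G a b →
           Reach G (U ∖ ⟦ v ⟧) (redirect v c a) (redirect v c b)
    edge {a} {b} a∈U b∈U e with v ≟ a | v ≟ b
    ... | yes _    | yes _    = here c∈
    ... | yes refl | no v≢b   = reach-sym (joins b (∈-minus b∈U v≢b) e)
    ... | no v≢a   | yes refl = joins a (∈-minus a∈U v≢a) (adj-sym {G} e)
    ... | no v≢a   | no v≢b   =
      step (∈-minus a∈U v≢a) e (here (∈-minus b∈U v≢b))

  reach-to-redirect : c ∈ U → Adj G v c → ∀ {a} → a ∈ U → Reach G U a (redirect v c a)
  reach-to-redirect c∈U v~c {a} a∈U with v ≟ a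
  ... | yes refl = step a∈U v~c (here c∈U)
  ... | no _     = here a∈U

  disconnected-insert : NeighboursInComponentOf G U v c →
                        Disconnected G (U ∖ ⟦ v ⟧) → Disconnected G U
  disconnected-insert nb (x , y , x∈ , y∈ , x↛y) =
    x , y , proj₁ (∈-∖⁻ U ⟦ v ⟧ x∈) , proj₁ (∈-∖⁻ U ⟦ v ⟧ y∈) ,
    λ r → x↛y (subst₂ (Reach G (U ∖ ⟦ v ⟧)) (fixed x∈) (fixed y∈) (reach-redirect nb r))
    where
    fixed : ∀ {z} → z ∈ (U ∖ ⟦ v ⟧) → redirect v c z ≡ z
    fixed z∈ = redirect-≢ (∉-⟦⟧⁻ (proj₂ (∈-∖⁻ U ⟦ v ⟧ z∈)))

  disconnected-delete : c ∈ U → Adj G v c → Disconnected G U → Disconnected G (U ∖ ⟦ v ⟧)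
  disconnected-delete c∈U v~c (x , y , x∈U , y∈U , x↛y) =
    redirect v c x , redirect v c y , redirect-∈ c∈ x∈U , redirect-∈ c∈ y∈U ,
    λ r → x↛y (reach-trans (reach-to-redirect c∈U v~c x∈U)
                (reach-trans (reach-mono (λ _ z∈ → proj₁ (∈-∖⁻ U ⟦ v ⟧ z∈)) r)
                  (reach-sym (reach-to-redirect c∈U v~c y∈U))))
    where
    c∈ : c ∈ (U ∖ ⟦ v ⟧)
    c∈ = ∈-minus c∈U (adj-≢ {G} v~c)

module _ {G : Graph} {v : Vertex G} {S : VSet G} where

  cutset-through-vertex : v ∈ S → StableCutsetIn G (All G) S →
                          StableCutsetIn G (All G ∖ ⟦ v ⟧) (S ∖ ⟦ v ⟧)
  cutset-through-vertex v∈S (_ , stable , disc) =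
      (λ z z∈ → ∈-∖ (All G) ⟦ v ⟧ refl (proj₂ (∈-∖⁻ S ⟦ v ⟧ z∈)))
    , (λ x y x∈ y∈ → stable x y (proj₁ (∈-∖⁻ S ⟦ v ⟧ x∈)) (proj₁ (∈-∖⁻ S ⟦ v ⟧ y∈)))
    , disconnected-resp-≗ (λ z → ≡-sym (∖-absorb (All G) S ⟦ v ⟧ v⊆S z)) disc
    where
    v⊆S : ∀ z → z ∈ ⟦ v ⟧ → z ∈ S
    v⊆S z z∈ = subst (_∈ S) (∈-⟦⟧⁻ z∈) v∈S

  cutset-beside-vertex : ∀ {c} → v ∉ S → c ∉ S → Adj G v c → StableCutsetIn G (All G) S →
                         StableCutsetIn G (All G ∖ ⟦ v ⟧) S
  cutset-beside-vertex v∉S c∉S v~c (_ , stable , disc) =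
      (λ z z∈S → ∈-∖ (All G) ⟦ v ⟧ refl (∉-⟦⟧ λ { refl → contradiction (trans (≡-sym v∉S) z∈S) λ () }))
    , stable
    , disconnected-resp-≗ (∖-comm (All G) S ⟦ v ⟧)
        (disconnected-delete (∈-∖ (All G) S refl c∉S) v~c disc)

  cutset-of-deleted : ∀ {c} → NeighboursInComponentOf G (All G ∖ S) v c →
                      StableCutsetIn G (All G ∖ ⟦ v ⟧) S → StableCutsetIn G (All G) S
  cutset-of-deleted nb (_ , stable , disc) =
    (λ _ _ → refl) , stable , disconnected-insert nb (disconnected-resp-≗ (∖-comm (All G) ⟦ v ⟧ S) disc)

SeesThreeParts : (G : Graph) → VSet G → ∀ {k} → (Vertex G → Fin k) → Vertex G → Set
SeesThreeParts G X p x =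
  ∃[ u₁ ] ∃[ u₂ ] ∃[ u₃ ] (u₁ ∉ X × u₂ ∉ X × u₃ ∉ X ×
    Adj G x u₁ × Adj G x u₂ × Adj G x u₃ ×
    p u₁ ≢ p u₂ × p u₁ ≢ p u₃ × p u₂ ≢ p u₃)

module CoClusterJoin {G : Graph} {X : VSet G} {k : ℕ} {p : Vertex G → Fin k}
                     (join : IsCoClusterJoin G X k p) where

  adj-across-parts : ∀ {u w} → u ∉ X → w ∉ X → p u ≢ p w → Adj G u w
  adj-across-parts {u} {w} u∉X w∉X pu≢pw =
    proj₂ (proj₂ join u w u∉X w∉X (λ u≡w → pu≢pw (cong p u≡w))) pu≢pw

  -- The default part a₀ is returned when S misses G − X.
  stable-within-a-part : ∀ {S} → Stable G S → Fin k → ∃[ a ] ∀ s → s ∈ S → s ∉ X → p s ≡ a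
  stable-within-a-part {S} stable a₀
    with any? (λ s → (S s ≟ᵇ true) ×-dec (X s ≟ᵇ false))
  ... | no none = a₀ , λ s s∈S s∉X → contradiction (s , s∈S , s∉X) none
  ... | yes (s₀ , s₀∈S , s₀∉X) = p s₀ , λ s s∈S s∉X → same-part s∈S s∉X
    where
    same-part : ∀ {s} → s ∈ S → s ∉ X → p s ≡ p s₀
    same-part {s} s∈S s∉X with p s ≟ p s₀
    ... | yes ps≡ps₀ = ps≡ps₀
    ... | no ps≢ps₀ = contradiction (adj-across-parts s∉X s₀∉X ps≢ps₀) (stable s s₀ s∈S s₀∈S)

  member : Fin k → Vertex G
  member i = proj₁ (proj₁ join i)

  member-∉ : ∀ i → member i ∉ X
  member-∉ i = proj₁ (proj₂ (proj₁ join i))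

  p-member : ∀ i → p (member i) ≡ i
  p-member i = proj₂ (proj₂ (proj₁ join i))

  member-≢ : ∀ {i j} → j ≢ i → p (member i) ≢ j
  member-≢ {i} j≢i e = j≢i (trans (≡-sym e) (p-member i))

  ≢-member : ∀ {u i} → p u ≢ i → p u ≢ p (member i)
  ≢-member {i = i} pu≢i e = pu≢i (trans e (p-member i))

  module Hub (four-parts : 4 ≤ k) {S : VSet G} (stable : Stable G S) {v : Vertex G} (v∉X : v ∉ X) where

    W : VSet G
    W = (All G ∖ S) ∖ ⟦ v ⟧

    a : Fin k
    a = proj₁ (stable-within-a-part stable (p v))

    S-in-a : ∀ s → s ∈ S → s ∉ X → p s ≡ a
    S-in-a = proj₂ (stable-within-a-part stable (p v))

    c-avoids : ∃[ c ] ∀ j → (a ∷ p v ∷ []) j ≢ c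
    c-avoids = missed-value (≤-trans (n≤1+n 3) four-parts) (a ∷ p v ∷ [])

    c : Fin k
    c = proj₁ c-avoids

    d-avoids : ∃[ d ] ∀ j → (a ∷ p v ∷ c ∷ []) j ≢ d
    d-avoids = missed-value four-parts (a ∷ p v ∷ c ∷ [])

    d : Fin k
    d = proj₁ d-avoids

    ∈-W : ∀ {u} → u ∉ X → p u ≢ a → p u ≢ p v → u ∈ W
    ∈-W {u} u∉X pu≢a pu≢pv = ∈-∖ (All G ∖ S) ⟦ v ⟧ (∈-∖ (All G) S refl u∉S) (∉-⟦⟧ v≢u)
      where
      u∉S : u ∉ S
      u∉S with S u in u∈?S
      ... | true  = contradiction (S-in-a u u∈?S u∉X) pu≢a
      ... | false = refl
      v≢u : v ≢ u
      v≢u refl = pu≢pv refl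

    classify : ∀ {u} → u ∉ X → u ∈ W ⊎ (p u ≡ a ⊎ p u ≡ p v)
    classify {u} u∉X with S u in u∈?S
    ... | true  = inj₂ (inj₁ (S-in-a u u∈?S u∉X))
    ... | false = case v ≟ u of λ where
      (yes refl) → inj₂ (inj₂ refl)
      (no v≢u)   → inj₁ (∈-∖ (All G ∖ S) ⟦ v ⟧ (∈-∖ (All G) S refl u∈?S) (∉-⟦⟧ v≢u))

    member-∈-W : ∀ {i} → a ≢ i → p v ≢ i → member i ∈ W
    member-∈-W {i} a≢i pv≢i = ∈-W (member-∉ i) (member-≢ a≢i) (member-≢ pv≢i)

    hub : Vertex G
    hub = member c

    hub-∈ : hub ∈ W
    hub-∈ = member-∈-W (proj₂ c-avoids zero) (proj₂ c-avoids (suc zero))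

    hub-∉ : hub ∉ S
    hub-∉ = proj₂ (∈-∖⁻ (All G) S (proj₁ (∈-∖⁻ (All G ∖ S) ⟦ v ⟧ hub-∈)))

    hub-adj : Adj G v hub
    hub-adj = adj-across-parts v∉X (member-∉ c) (≢-member (proj₂ c-avoids (suc zero)))

    reaches-hub : ∀ {u} → u ∉ X → u ∈ W → Reach G W u hub
    reaches-hub {u} u∉X u∈W with p u ≟ c
    ... | no pu≢c  = step u∈W (adj-across-parts u∉X (member-∉ c) (≢-member pu≢c)) (here hub-∈)
    ... | yes pu≡c =
      step u∈W (adj-across-parts u∉X (member-∉ d) (≢-member λ pu≡d → c≢d (trans (≡-sym pu≡c) pu≡d)))
        (step (member-∈-W (proj₂ d-avoids zero) (proj₂ d-avoids (suc zero)))
          (adj-across-parts (member-∉ d) (member-∉ c) (≢-member (member-≢ c≢d)))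
          (here hub-∈))
      where
      c≢d : c ≢ d
      c≢d = proj₂ d-avoids (suc (suc zero))

    adjacent-to-W : ∀ {x} → SeesThreeParts G X p x → ∃[ u ] (u ∉ X × u ∈ W × Adj G x u)
    adjacent-to-W (u₁ , u₂ , u₃ , u₁∉X , u₂∉X , u₃∉X , x~u₁ , x~u₂ , x~u₃ , p₁≢p₂ , p₁≢p₃ , p₂≢p₃)
      with classify u₁∉X | classify u₂∉X | classify u₃∉X
    ... | inj₁ u₁∈W | _         | _         = u₁ , u₁∉X , u₁∈W , x~u₁
    ... | inj₂ _    | inj₁ u₂∈W | _         = u₂ , u₂∉X , u₂∈W , x~u₂
    ... | inj₂ _    | inj₂ _    | inj₁ u₃∈W = u₃ , u₃∉X , u₃∈W , x~u₃
    ... | inj₂ in₁  | inj₂ in₂  | inj₂ in₃  =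
      contradiction in₃ (no-three-distinct-in-pair p₁≢p₂ p₁≢p₃ p₂≢p₃ in₁ in₂)

    neighbours-join-hub : (∀ x → x ∈ X → Adj G v x → SeesThreeParts G X p x) →
                          NeighboursInComponentOf G (All G ∖ S) v hub
    neighbours-join-hub sees = record { centre-∈ = hub-∈ ; neighbour-reaches = joins }
      where
      joins : ∀ z → z ∈ W → Adj G v z → Reach G W z hub
      joins z z∈W v~z with X z in z∈?X
      ... | false = reaches-hub z∈?X z∈W
      ... | true with u , u∉X , u∈W , z~u ← adjacent-to-W (sees z z∈?X v~z) =
        step z∈W z~u (reaches-hub u∉X u∈W)

lemma13 : (G : Graph) → Connected G (All G) → (∀ v → ¬ IsCutVertex G v) → ¬ IsClique G →
    (∀ v → ¬ Stable G (N G v)) →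
    (X : VSet G) → (k : ℕ) → 4 ≤ k → (p : Vertex G → Fin k) → IsCoClusterJoin G X k p →
    (v : Vertex G) → v ∉ X →
    (∀ x → x ∈ X → Adj G v x →
       ∃[ u₁ ] ∃[ u₂ ] ∃[ u₃ ] (u₁ ∉ X × u₂ ∉ X × u₃ ∉ X ×
         Adj G x u₁ × Adj G x u₂ × Adj G x u₃ ×
         p u₁ ≢ p u₂ × p u₁ ≢ p u₃ × p u₂ ≢ p u₃)) →
    (HasStableCutset G → HasStableCutsetMinus G v) × (HasStableCutsetMinus G v → HasStableCutset G)
lemma13 G _ _ _ _ X k four-parts p join v v∉X sees = forward , backward
  where
  open CoClusterJoin join

  forward : HasStableCutset G → HasStableCutsetMinus G v
  forward (S , cutset) with S v in v∈?S
  ... | true  = S ∖ ⟦ v ⟧ , cutset-through-vertex v∈?S cutset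
  ... | false = S , cutset-beside-vertex v∈?S hub-∉ hub-adj cutset
    where open Hub four-parts (proj₁ (proj₂ cutset)) v∉X

  backward : HasStableCutsetMinus G v → HasStableCutset G
  backward (S , cutset) = S , cutset-of-deleted (neighbours-join-hub sees) cutset
    where open Hub four-parts (proj₁ (proj₂ cutset)) v∉X
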